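{- Let $\mu=\frac{ -1+\sqrt7 i}{2}$ and $\bar\mu=\frac{ -1-\sqrt7 i}{2}$. For every $r\ge0$, $$a_r = \frac14\cdot 2^r + \left(\frac{ -7+5\sqrt7 i}{56}\right)\mu^r + \left(\frac{ -7-5\sqrt7 i}{56}\right)\bar\mu^r.$$
   Context: The Stern sequence $(s(n))_{n\ge0}$ is defined by $s(0)=0$, $s(1)=1$, $s(2n)=s(n)$, $s(2n+1)=s(n)+s(n+1)$. For $r\ge0$, let $a_r=|\{n: 2^r\le n<2^{r+1},\ 3\mid s(n)\}|$. -}

module Defs where

open import Data.Nat using (ℕ; zero; suc; _+_; _^_; _%_) renaming (_/_ to _÷_)
open import Data.Nat.Divisibility using (_∣?_)
open import Data.List using (List; map; upTo; filter; length)
open import Data.Integer using (+_; -[1+_])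
open import Data.Rational using (ℚ; _/_) renaming (_+_ to _+ℚ_; _*_ to _*ℚ_; -_ to -ℚ_; 0ℚ to 0q; 1ℚ to 1q)

-- Stern's diatomic sequence:  s(0)=0, s(1)=1, s(2n)=s(n), s(2n+1)=s(n)+s(n+1).
-- Implemented by fuel-bounded recursion; with fuel k ≥ n the value is exact
-- (all recursive arguments are < n for n ≥ 2, and fuel decreases by one).

sternF : ℕ → ℕ → ℕ
sternF zero    _ = 0
sternF (suc k) 0 = 0
sternF (suc k) 1 = 1
sternF (suc k) n@(suc (suc _)) with n % 2
... | 0 = sternF k (n ÷ 2)
... | _ = sternF k (n ÷ 2) + sternF k (suc (n ÷ 2))

stern : ℕ → ℕ
stern n = sternF n n

a : ℕ → ℕ
a r = length (filter (λ n → 3 ∣? stern n) (map (λ k → 2 ^ r + k) (upTo (2 ^ r))))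

-- The field ℚ(√-7) ⊂ ℂ: elements re + im·√7·i with re, im ∈ ℚ.
-- All numbers in the closed formula lie in this subfield of ℂ.

record Q√-7 : Set where
  constructor _+_√-7
  field
    re : ℚ
    im : ℚ

open Q√-7 public

infixl 6 _⊕_
infixl 7 _⊗_

_⊕_ : Q√-7 → Q√-7 → Q√-7
(a₁ + b₁ √-7) ⊕ (a₂ + b₂ √-7) = (a₁ +ℚ a₂) + (b₁ +ℚ b₂) √-7

-- (a + b√-7)(c + d√-7) = (ac - 7bd) + (ad + bc)√-7
_⊗_ : Q√-7 → Q√-7 → Q√-7
(a₁ + b₁ √-7) ⊗ (a₂ + b₂ √-7) =
  ((a₁ *ℚ a₂) +ℚ (-ℚ ((+ 7 / 1) *ℚ (b₁ *ℚ b₂)))) + ((a₁ *ℚ b₂) +ℚ (b₁ *ℚ a₂)) √-7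

one : Q√-7
one = 1q + 0q √-7

_^q_ : Q√-7 → ℕ → Q√-7
x ^q zero  = one
x ^q suc n = x ⊗ (x ^q n)

ι : ℕ → Q√-7
ι n = (+ n / 1) + 0q √-7

μ μ̄ : Q√-7
μ  = (-[1+ 0 ] / 2) + (+ 1 / 2) √-7
μ̄  = (-[1+ 0 ] / 2) + (-[1+ 0 ] / 2) √-7

c c̄ : Q√-7
c  = (-[1+ 6 ] / 56) + (+ 5 / 56) √-7
c̄  = (-[1+ 6 ] / 56) + (-[1+ 4 ] / 56) √-7

quarter : Q√-7
quarter = (+ 1 / 4) + 0q √-7

{-# OPTIONS --safe #-}
module Submission where

open import Data.Bool using (true; false; if_then_else_)
open import Data.Fin using (Fin; zero; suc; toℕ)
open import Data.Fin.Properties using (toℕ-injective; toℕ-fromℕ<)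
import Data.Integer as ℤ
import Data.Integer.Properties as ℤₚ
open import Data.List using (List; []; _∷_; map; upTo; applyUpTo; filter; length)
open import Data.List.Properties using (map-cong; map-∘; map-upTo)
open import Data.Nat using (ℕ; zero; suc; _+_; _*_; _^_; _%_; _≤_; z≤n; s≤s; NonZero) renaming (_/_ to _÷_)
open import Data.Nat.Coprimality using (1-coprimeTo) renaming (sym to coprime-sym)
open import Data.Nat.Divisibility using (_∣?_)
open import Data.Nat.DivMod using (_mod_; %-distribˡ-+; m/n≡1+[m∸n]/n)
open import Data.Nat.ListAction using (sum)
open import Data.Nat.Properties
  using (+-suc; +-assoc; +-comm; +-identityʳ; *-zeroʳ; *-distribˡ-+; *-cancelˡ-≡; ≤-trans; ≤-refl; <⇒≤; m≤m+n; m≤n⇒m≤1+n)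
open import Data.Nat.Tactic.RingSolver using (solve-∀)
open import Data.Rational using (mkℚ; _/_; 0ℚ) renaming (_+_ to _+ℚ_; _*_ to _*ℚ_; -_ to -ℚ_)
open import Data.Rational.Properties using (normalize-coprime)
open import Data.Rational.Solver using (module +-*-Solver)
open import Function using (_∘_; flip)
open import Relation.Binary.PropositionalEquality using (_≡_; _≗_; refl; sym; trans; cong; cong₂; subst; module ≡-Reasoning)
open import Relation.Nullary using (does)
open import Relation.Unary using (Pred; Decidable)
open import Defs

-- Follow the pair (s(n), s(n+1)) mod 3 along the rows 2^r ≤ n < 2^(r+1).  The children 2n and 2n+1
-- of n carry the pairs (x, x+y) and (x+y, y), so summing a weight g on pairs over row r+1 is summing
-- (x, y) ↦ g(x, x+y) + g(x+y, y) over row r; row 0 is the single pair (1, 1).  Swapping the pair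
-- commutes with this step and fixes (1, 1), so row sums only see the symmetrisation g(x, y) + g(y, x).
-- For the indicator χ of x ≡ 0, whose row sums are the a_r, three steps and "two steps plus 4χ" differ
-- by an antisymmetric weight, whence a_(r+3) = a_(r+2) + 4 a_r.  The closed form satisfies the same
-- recurrence since 2, μ, μ̄ are the roots of t³ − t² − 4, and both sides agree for r = 0, 1, 2.

module _ {A : Set} where

  length-filter : ∀ {p} {P : Pred A p} (P? : Decidable P) xs →
                  length (filter P? xs) ≡ sum (map (λ x → if does (P? x) then 1 else 0) xs)
  length-filter P? []       = refl
  length-filter P? (x ∷ xs) with does (P? x)
  ... | true  = cong suc (length-filter P? xs)
  ... | false = length-filter P? xs

  sum-map-+ : ∀ (f g : A → ℕ) xs → sum (map (λ x → f x + g x) xs) ≡ sum (map f xs) + sum (map g xs)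
  sum-map-+ f g []       = refl
  sum-map-+ f g (x ∷ xs) = trans (cong (f x + g x +_) (sum-map-+ f g xs)) (interchange (f x) (g x) _ _)
    where
    interchange : ∀ a b c d → a + b + (c + d) ≡ a + c + (b + d)
    interchange = solve-∀

  sum-map-* : ∀ k (f : A → ℕ) xs → sum (map (λ x → k * f x) xs) ≡ k * sum (map f xs)
  sum-map-* k f []       = sym (*-zeroʳ k)
  sum-map-* k f (x ∷ xs) = trans (cong (k * f x +_) (sum-map-* k f xs)) (sym (*-distribˡ-+ k (f x) _))

applyUpTo-cong : ∀ {A : Set} {f g : ℕ → A} → f ≗ g → applyUpTo f ≗ applyUpTo g
applyUpTo-cong f≗g n = trans (sym (map-upTo _ n)) (trans (map-cong f≗g (upTo n)) (map-upTo _ n))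

sum-applyUpTo-pairs : ∀ (f : ℕ → ℕ) n →
  sum (applyUpTo f (n + n)) ≡ sum (applyUpTo (λ k → f (k + k) + f (suc (k + k))) n)
sum-applyUpTo-pairs f zero    = refl
sum-applyUpTo-pairs f (suc n) rewrite +-suc n n =
  trans (sym (+-assoc (f 0) (f 1) _))
        (cong (f 0 + f 1 +_) (trans (sum-applyUpTo-pairs (λ k → f (2 + k)) n)
                                    (cong sum (applyUpTo-cong regroup n))))
  where
  regroup : ∀ k → f (2 + (k + k)) + f (3 + (k + k)) ≡ f (suc k + suc k) + f (suc (suc k + suc k))
  regroup k = cong (λ j → f (suc j) + f (2 + j)) (sym (+-suc k k))

data Halving : ℕ → Set where
  isZero : Halving 0
  isOne  : Halving 1
  even : ∀ m → Halving (2 + (m + m))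
  odd  : ∀ m → Halving (3 + (m + m))

halving : ∀ n → Halving n
halving 0 = isZero
halving 1 = isOne
halving (suc (suc n)) with halving n
... | isZero = even 0
... | isOne  = odd 0
... | even m = subst (λ k → Halving (3 + k)) (+-suc m m) (even (suc m))
... | odd m  = subst (λ k → Halving (4 + k)) (+-suc m m) (odd (suc m))

[2+n]/2≡1+n/2 : ∀ n → (2 + n) ÷ 2 ≡ suc (n ÷ 2)
[2+n]/2≡1+n/2 n = m/n≡1+[m∸n]/n {2 + n} {2} (s≤s (s≤s z≤n))

[m+m]/2≡m : ∀ m → (m + m) ÷ 2 ≡ m
[m+m]/2≡m zero    = refl
[m+m]/2≡m (suc m) rewrite +-suc m m = trans ([2+n]/2≡1+n/2 (m + m)) (cong suc ([m+m]/2≡m m))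

[1+m+m]/2≡m : ∀ m → suc (m + m) ÷ 2 ≡ m
[1+m+m]/2≡m zero    = refl
[1+m+m]/2≡m (suc m) rewrite +-suc m m = trans ([2+n]/2≡1+n/2 (suc (m + m))) (cong suc ([1+m+m]/2≡m m))

[m+m]%2≡0 : ∀ m → (m + m) % 2 ≡ 0
[m+m]%2≡0 zero    = refl
[m+m]%2≡0 (suc m) rewrite +-suc m m = [m+m]%2≡0 m

[1+m+m]%2≡1 : ∀ m → suc (m + m) % 2 ≡ 1
[1+m+m]%2≡1 zero    = refl
[1+m+m]%2≡1 (suc m) rewrite +-suc m m = [1+m+m]%2≡1 m

sternF-even : ∀ k m → sternF (suc k) (2 + (m + m)) ≡ sternF k (suc m)
sternF-even k m rewrite [m+m]%2≡0 m | [2+n]/2≡1+n/2 (m + m) | [m+m]/2≡m m = refl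

sternF-odd : ∀ k m → sternF (suc k) (3 + (m + m)) ≡ sternF k (suc m) + sternF k (2 + m)
sternF-odd k m rewrite [1+m+m]%2≡1 m | [2+n]/2≡1+n/2 (suc (m + m)) | [1+m+m]/2≡m m = refl

sternF-fuel : ∀ {j k} n → n ≤ j → n ≤ k → sternF j n ≡ sternF k n
sternF-fuel n = go (halving n)
  where
  go : ∀ {j k n} → Halving n → n ≤ j → n ≤ k → sternF j n ≡ sternF k n
  go {zero}  {zero}  isZero _ _ = refl
  go {zero}  {suc _} isZero _ _ = refl
  go {suc _} {zero}  isZero _ _ = refl
  go {suc _} {suc _} isZero _ _ = refl
  go {suc _} {suc _} isOne  _ _ = refl
  go {suc j} {suc k} (even m) (s≤s p) (s≤s q) =
    trans (sternF-even j m) (trans (sternF-fuel (suc m) (half≤ p) (half≤ q)) (sym (sternF-even k m)))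
    where
    half≤ : ∀ {i} → suc (m + m) ≤ i → suc m ≤ i
    half≤ = ≤-trans (s≤s (m≤m+n m m))
  go {suc j} {suc k} (odd m)  (s≤s p) (s≤s q) =
    trans (sternF-odd j m)
      (trans (cong₂ _+_ (sternF-fuel (suc m) (<⇒≤ (half≤ p)) (<⇒≤ (half≤ q)))
                        (sternF-fuel (2 + m) (half≤ p) (half≤ q)))
             (sym (sternF-odd k m)))
    where
    half≤ : ∀ {i} → 2 + (m + m) ≤ i → 2 + m ≤ i
    half≤ = ≤-trans (s≤s (s≤s (m≤m+n m m)))

stern-double+2 : ∀ m → stern (2 + (m + m)) ≡ stern (suc m)
stern-double+2 m =
  trans (sternF-even (suc (m + m)) m) (sternF-fuel (suc m) (s≤s (m≤m+n m m)) ≤-refl)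

stern-double+3 : ∀ m → stern (3 + (m + m)) ≡ stern (suc m) + stern (2 + m)
stern-double+3 m = trans (sternF-odd (2 + (m + m)) m)
  (cong₂ _+_ (sternF-fuel (suc m) (m≤n⇒m≤1+n (s≤s (m≤m+n m m))) ≤-refl)
             (sternF-fuel (2 + m) (s≤s (s≤s (m≤m+n m m))) ≤-refl))

stern-double : ∀ n → stern (n + n) ≡ stern n
stern-double zero    = refl
stern-double (suc m) = trans (cong (λ k → stern (suc k)) (+-suc m m)) (stern-double+2 m)

stern-double+1 : ∀ n → stern (suc (n + n)) ≡ stern n + stern (suc n)
stern-double+1 zero    = refl
stern-double+1 (suc m) = trans (cong (λ k → stern (2 + k)) (+-suc m m)) (stern-double+3 m)

row : ℕ → List ℕ
row r = map (2 ^ r +_) (upTo (2 ^ r))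

sum-map-row-suc : ∀ (f : ℕ → ℕ) r →
  sum (map f (row (suc r))) ≡ sum (map (λ n → f (n + n) + f (suc (n + n))) (row r))
sum-map-row-suc f r = begin
  sum (map f (row (suc r)))
    ≡⟨ cong (λ M → sum (map f (map (M +_) (upTo M)))) 2N≡N+N ⟩
  sum (map f (map (N + N +_) (upTo (N + N))))
    ≡⟨ cong sum (trans (sym (map-∘ (upTo (N + N)))) (map-upTo _ (N + N))) ⟩
  sum (applyUpTo (f ∘ (N + N +_)) (N + N))
    ≡⟨ sum-applyUpTo-pairs _ N ⟩
  sum (applyUpTo (λ k → f (N + N + (k + k)) + f (N + N + suc (k + k))) N)
    ≡⟨ cong sum (applyUpTo-cong regroup N) ⟩
  sum (applyUpTo (g ∘ (N +_)) N)
    ≡⟨ cong sum (trans (sym (map-upTo _ N)) (map-∘ (upTo N))) ⟩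
  sum (map g (row r))
    ∎
  where
  open ≡-Reasoning
  N = 2 ^ r
  g : ℕ → ℕ
  g n = f (n + n) + f (suc (n + n))
  2N≡N+N : 2 ^ suc r ≡ N + N
  2N≡N+N = cong (N +_) (+-identityʳ N)
  interchange : ∀ a b → a + a + (b + b) ≡ (a + b) + (a + b)
  interchange = solve-∀
  regroup : ∀ k → f (N + N + (k + k)) + f (N + N + suc (k + k)) ≡ g (N + k)
  regroup k = trans (cong (λ j → f (N + N + (k + k)) + f j) (+-suc (N + N) (k + k)))
                    (cong (λ j → f j + f (suc j)) (interchange N k))

module SternPairsMod (m : ℕ) .{{_ : NonZero m}} where

  infixl 6 _⊞_

  _⊞_ : Fin m → Fin m → Fin m
  i ⊞ j = (toℕ i + toℕ j) mod m

  ⊞-comm : ∀ i j → i ⊞ j ≡ j ⊞ i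
  ⊞-comm i j = cong (_mod m) (+-comm (toℕ i) (toℕ j))

  mod-distrib-+ : ∀ x y → (x + y) mod m ≡ x mod m ⊞ y mod m
  mod-distrib-+ x y = toℕ-injective (begin
    toℕ ((x + y) mod m)                    ≡⟨ toℕ-mod (x + y) ⟩
    (x + y) % m                            ≡⟨ %-distribˡ-+ x y m ⟩
    (x % m + y % m) % m                    ≡⟨ cong₂ (λ u v → (u + v) % m) (toℕ-mod x) (toℕ-mod y) ⟨
    (toℕ (x mod m) + toℕ (y mod m)) % m    ≡⟨ toℕ-mod _ ⟨
    toℕ (x mod m ⊞ y mod m)                ∎)
    where
    open ≡-Reasoning
    toℕ-mod : ∀ z → toℕ (z mod m) ≡ z % m
    toℕ-mod z = toℕ-fromℕ< _

  Weight : Set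
  Weight = Fin m → Fin m → ℕ

  count : ℕ → Weight → ℕ
  count r g = sum (map (λ n → g (stern n mod m) (stern (suc n) mod m)) (row r))

  childSum : Weight → Weight
  childSum g x y = g x (x ⊞ y) + g (x ⊞ y) y

  childSum^ : ℕ → Weight → Weight
  childSum^ zero    g = g
  childSum^ (suc k) g = childSum^ k (childSum g)

  count-cong : ∀ r {g h : Weight} → (∀ x y → g x y ≡ h x y) → count r g ≡ count r h
  count-cong r g≡h = cong sum (map-cong (λ _ → g≡h _ _) (row r))

  count-+ : ∀ r (g h : Weight) → count r (λ x y → g x y + h x y) ≡ count r g + count r h
  count-+ r g h = sum-map-+ _ _ (row r)

  count-* : ∀ r k (g : Weight) → count r (λ x y → k * g x y) ≡ k * count r g
  count-* r k g = sum-map-* k _ (row r)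

  count-suc : ∀ r g → count (suc r) g ≡ count r (childSum g)
  count-suc r g = trans (sum-map-row-suc _ r) (cong sum (map-cong children (row r)))
    where
    children : ∀ n → g (stern (n + n) mod m) (stern (suc (n + n)) mod m)
                     + g (stern (suc (n + n)) mod m) (stern (2 + (n + n)) mod m)
                   ≡ childSum g (stern n mod m) (stern (suc n) mod m)
    children n rewrite stern-double n | stern-double+1 n | stern-double+2 n
                     | mod-distrib-+ (stern n) (stern (suc n)) = refl

  count-descend : ∀ k r g → count (k + r) g ≡ count r (childSum^ k g)
  count-descend zero    r g = refl
  count-descend (suc k) r g = trans (count-suc (k + r) g) (count-descend k r (childSum g))

  childSum-flip : ∀ g x y → childSum (flip g) x y ≡ flip (childSum g) x y
  childSum-flip g x y = trans (+-comm (g (x ⊞ y) x) _) (cong (λ z → g y z + g z x) (⊞-comm x y))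

  count-flip : ∀ r g → count r (flip g) ≡ count r g
  count-flip zero    g = refl
  count-flip (suc r) g = begin
    count (suc r) (flip g)       ≡⟨ count-suc r (flip g) ⟩
    count r (childSum (flip g))  ≡⟨ count-cong r (childSum-flip g) ⟩
    count r (flip (childSum g))  ≡⟨ count-flip r (childSum g) ⟩
    count r (childSum g)         ≡⟨ count-suc r g ⟨
    count (suc r) g              ∎
    where open ≡-Reasoning

  count-cong-symmetrised : ∀ r (g h : Weight) → (∀ x y → g x y + g y x ≡ h x y + h y x) →
                           count r g ≡ count r h
  count-cong-symmetrised r g h g≈h =
    *-cancelˡ-≡ _ _ 2 (trans (sym (symmetrise g)) (trans (count-cong r g≈h) (symmetrise h)))
    where
    symmetrise : ∀ f → count r (λ x y → f x y + f y x) ≡ 2 * count r f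
    symmetrise f = begin
      count r (λ x y → f x y + f y x)  ≡⟨ count-+ r f (flip f) ⟩
      count r f + count r (flip f)     ≡⟨ cong (count r f +_) (count-flip r f) ⟩
      count r f + count r f            ≡⟨ cong (count r f +_) (+-identityʳ _) ⟨
      2 * count r f                    ∎
      where open ≡-Reasoning

open SternPairsMod 3

firstZero : Weight
firstZero zero    _ = 1
firstZero (suc _) _ = 0

indicator-3∣ : ∀ x y → (if does (3 ∣? x) then 1 else 0) ≡ firstZero (x mod 3) y
indicator-3∣ 0 _ = refl
indicator-3∣ 1 _ = refl
indicator-3∣ 2 _ = refl
indicator-3∣ (suc (suc (suc x))) = indicator-3∣ x   -- both sides only see (3 + x) % 3 = x % 3

a≡count : ∀ r → a r ≡ count r firstZero
a≡count r = trans (length-filter (λ n → 3 ∣? stern n) (row r))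
                  (cong sum (map-cong (λ n → indicator-3∣ (stern n) (stern (suc n) mod 3)) (row r)))

recurrence-weights : ∀ x y →
  childSum^ 3 firstZero x y + childSum^ 3 firstZero y x
    ≡ (childSum^ 2 firstZero x y + 4 * firstZero x y) + (childSum^ 2 firstZero y x + 4 * firstZero y x)
recurrence-weights zero             zero             = refl
recurrence-weights zero             (suc zero)       = refl
recurrence-weights zero             (suc (suc zero)) = refl
recurrence-weights (suc zero)       zero             = refl
recurrence-weights (suc zero)       (suc zero)       = refl
recurrence-weights (suc zero)       (suc (suc zero)) = refl
recurrence-weights (suc (suc zero)) zero             = refl
recurrence-weights (suc (suc zero)) (suc zero)       = refl
recurrence-weights (suc (suc zero)) (suc (suc zero)) = refl

a-rec : ∀ r → a (3 + r) ≡ a (2 + r) + 4 * a r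
a-rec r = begin
  a (3 + r)
    ≡⟨ a≡count (3 + r) ⟩
  count (3 + r) χ
    ≡⟨ count-descend 3 r χ ⟩
  count r (childSum^ 3 χ)
    ≡⟨ count-cong-symmetrised r (childSum^ 3 χ) w recurrence-weights ⟩
  count r w
    ≡⟨ count-+ r (childSum^ 2 χ) (λ x y → 4 * χ x y) ⟩
  count r (childSum^ 2 χ) + count r (λ x y → 4 * χ x y)
    ≡⟨ cong₂ _+_ (sym (count-descend 2 r χ)) (count-* r 4 χ) ⟩
  count (2 + r) χ + 4 * count r χ
    ≡⟨ cong₂ (λ u v → u + 4 * v) (a≡count (2 + r)) (a≡count r) ⟨
  a (2 + r) + 4 * a r
    ∎
  where
  open ≡-Reasoning
  χ = firstZero
  w : Weight
  w x y = childSum^ 2 χ x y + 4 * χ x y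

open +-*-Solver using (solve; _:=_; _:+_; _:*_; :-_)

⊗-distribˡ-⊕ : ∀ x y z → x ⊗ (y ⊕ z) ≡ x ⊗ y ⊕ x ⊗ z
⊗-distribˡ-⊕ x y z = cong₂ _+_√-7 (re-distrib (ℤ.+ 7 / 1) (re x) (im x) (re y) (im y) (re z) (im z))
                                  (im-distrib (re x) (im x) (re y) (im y) (re z) (im z))
  where
  re-distrib : ∀ s a b c d e f → a *ℚ (c +ℚ e) +ℚ -ℚ (s *ℚ (b *ℚ (d +ℚ f)))
                               ≡ (a *ℚ c +ℚ -ℚ (s *ℚ (b *ℚ d))) +ℚ (a *ℚ e +ℚ -ℚ (s *ℚ (b *ℚ f)))
  re-distrib = solve 7 (λ s a b c d e f → a :* (c :+ e) :+ :- (s :* (b :* (d :+ f)))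
                             := (a :* c :+ :- (s :* (b :* d))) :+ (a :* e :+ :- (s :* (b :* f)))) refl
  im-distrib : ∀ a b c d e f → a *ℚ (d +ℚ f) +ℚ b *ℚ (c +ℚ e) ≡ (a *ℚ d +ℚ b *ℚ c) +ℚ (a *ℚ f +ℚ b *ℚ e)
  im-distrib = solve 6 (λ a b c d e f → a :* (d :+ f) :+ b :* (c :+ e)
                           := (a :* d :+ b :* c) :+ (a :* f :+ b :* e)) refl

4×_ : Q√-7 → Q√-7
4× x = x ⊕ (x ⊕ (x ⊕ x))

⊕-interchange-4× : ∀ y x y′ x′ → (y ⊕ 4× x) ⊕ (y′ ⊕ 4× x′) ≡ (y ⊕ y′) ⊕ 4× (x ⊕ x′)
⊕-interchange-4× y x y′ x′ =
  cong₂ _+_√-7 (interchange (re y) (re x) (re y′) (re x′)) (interchange (im y) (im x) (im y′) (im x′))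
  where
  interchange : ∀ a b c d → (a +ℚ (b +ℚ (b +ℚ (b +ℚ b)))) +ℚ (c +ℚ (d +ℚ (d +ℚ (d +ℚ d))))
                          ≡ (a +ℚ c) +ℚ ((b +ℚ d) +ℚ ((b +ℚ d) +ℚ ((b +ℚ d) +ℚ (b +ℚ d))))
  interchange = solve 4 (λ a b c d → (a :+ (b :+ (b :+ (b :+ b)))) :+ (c :+ (d :+ (d :+ (d :+ d))))
                                   := (a :+ c) :+ ((b :+ d) :+ ((b :+ d) :+ ((b :+ d) :+ (b :+ d))))) refl

ι-+ : ∀ m n → ι (m + n) ≡ ι m ⊕ ι n
ι-+ m n = cong (_+ 0ℚ √-7) (begin
  ℤ.+ (m + n) / 1
    ≡⟨ cong₂ (λ i j → (i ℤ.+ j) / 1) (ℤₚ.*-identityʳ (ℤ.+ m)) (ℤₚ.*-identityʳ (ℤ.+ n)) ⟨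
  (ℤ.+ m ℤ.* ℤ.+ 1 ℤ.+ ℤ.+ n ℤ.* ℤ.+ 1) / 1
    ≡⟨ cong₂ _+ℚ_ (+n/1≡mkℚ m) (+n/1≡mkℚ n) ⟨
  ℤ.+ m / 1 +ℚ ℤ.+ n / 1
    ∎)
  where
  open ≡-Reasoning
  +n/1≡mkℚ : ∀ k → ℤ.+ k / 1 ≡ mkℚ (ℤ.+ k) 0 (coprime-sym (1-coprimeTo k))
  +n/1≡mkℚ k = normalize-coprime (coprime-sym (1-coprimeTo k))

ι-4* : ∀ n → ι (4 * n) ≡ 4× ι n
ι-4* n = trans (cong ι (4n≡n+[n+[n+n]] n))
  (trans (ι-+ n _) (cong (ι n ⊕_) (trans (ι-+ n _) (cong (ι n ⊕_) (ι-+ n n)))))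
  where
  4n≡n+[n+[n+n]] : ∀ n → 4 * n ≡ n + (n + (n + n))
  4n≡n+[n+[n+n]] = solve-∀

Recurrent : (ℕ → Q√-7) → Set
Recurrent u = ∀ r → u (3 + r) ≡ u (2 + r) ⊕ 4× u r

recurrent-unique : ∀ {u v} → Recurrent u → Recurrent v →
                   u 0 ≡ v 0 → u 1 ≡ v 1 → u 2 ≡ v 2 → ∀ r → u r ≡ v r
recurrent-unique {u} {v} ru rv e₀ e₁ e₂ = go
  where
  go : ∀ r → u r ≡ v r
  go 0 = e₀
  go 1 = e₁
  go 2 = e₂
  go (suc (suc (suc r))) =
    trans (ru r) (trans (cong₂ (λ y x → y ⊕ 4× x) (go (suc (suc r))) (go r)) (sym (rv r)))

ι-recurrent : ∀ f → (∀ r → f (3 + r) ≡ f (2 + r) + 4 * f r) → Recurrent (ι ∘ f)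
ι-recurrent f rec r =
  trans (cong ι (rec r)) (trans (ι-+ (f (2 + r)) _) (cong (ι (f (2 + r)) ⊕_) (ι-4* (f r))))

recurrent-⊕ : ∀ u v → Recurrent u → Recurrent v → Recurrent (λ r → u r ⊕ v r)
recurrent-⊕ u v ru rv r =
  trans (cong₂ _⊕_ (ru r) (rv r)) (⊕-interchange-4× (u (2 + r)) (u r) (v (2 + r)) (v r))

⊗-distribˡ-⊕-4× : ∀ k y x → k ⊗ (y ⊕ 4× x) ≡ k ⊗ y ⊕ 4× (k ⊗ x)
⊗-distribˡ-⊕-4× k y x =
  trans (⊗-distribˡ-⊕ k y (4× x)) (cong (k ⊗ y ⊕_)
    (trans (⊗-distribˡ-⊕ k x _) (cong (k ⊗ x ⊕_)
      (trans (⊗-distribˡ-⊕ k x _) (cong (k ⊗ x ⊕_) (⊗-distribˡ-⊕ k x x))))))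

recurrent-⊗ : ∀ k u → Recurrent u → Recurrent (λ r → k ⊗ u r)
recurrent-⊗ k u ru r = trans (cong (k ⊗_) (ru r)) (⊗-distribˡ-⊕-4× k (u (2 + r)) (u r))

recurrent-^q : ∀ z → z ^q 3 ≡ z ^q 2 ⊕ 4× (z ^q 0) → Recurrent (z ^q_)
recurrent-^q z root zero    = root
recurrent-^q z root (suc r) =
  trans (cong (z ⊗_) (recurrent-^q z root r)) (⊗-distribˡ-⊕-4× z (z ^q (2 + r)) (z ^q r))

2^-rec : ∀ r → 2 ^ (3 + r) ≡ 2 ^ (2 + r) + 4 * 2 ^ r
2^-rec r = 8x≡4x+4x (2 ^ r)
  where
  8x≡4x+4x : ∀ x → 2 * (2 * (2 * x)) ≡ 2 * (2 * x) + 4 * x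
  8x≡4x+4x = solve-∀

closedForm-recurrent : Recurrent (λ r → quarter ⊗ ι (2 ^ r) ⊕ c ⊗ (μ ^q r) ⊕ c̄ ⊗ (μ̄ ^q r))
closedForm-recurrent =
  recurrent-⊕ (λ r → quarter ⊗ ι (2 ^ r) ⊕ c ⊗ (μ ^q r)) (λ r → c̄ ⊗ (μ̄ ^q r))
    (recurrent-⊕ (λ r → quarter ⊗ ι (2 ^ r)) (λ r → c ⊗ (μ ^q r))
      (recurrent-⊗ quarter (ι ∘ (2 ^_)) (ι-recurrent (2 ^_) 2^-rec))
      (recurrent-⊗ c (μ ^q_) (recurrent-^q μ refl)))
    (recurrent-⊗ c̄ (μ̄ ^q_) (recurrent-^q μ̄ refl))

theorem5p3 : (r : ℕ) → ι (a r) ≡ quarter ⊗ ι (2 ^ r) ⊕ c ⊗ (μ ^q r) ⊕ c̄ ⊗ (μ̄ ^q r)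
theorem5p3 = recurrent-unique (ι-recurrent a a-rec) closedForm-recurrent refl refl refl
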